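{- For every integer $h\ge1$, let $t_{n,m,h}$ be the number of active growing binary trees of height $h$ with $n$ internal nodes and $m$ anchors, and let $S_h=\{(n,k)\in\mathbb{Z}_{>0}^2 : t_{n,2k,h}\neq0\}$. Then, as $h\to\infty$, the normalized set $\{(n/2^{h-1},\,k/2^{h-1}) : (n,k)\in S_h\}\subset\mathbb{R}^2$ converges (in Hausdorff distance) to the closed triangle with vertices $(0,0)$, $(1,0)$ and $(2,1)$.
   Context: Growing binary trees are plane (ordered) binary trees whose nodes are of three types: internal nodes, anchors (active leaves) and dead leaves. They are produced by the following growth process: at time $t=0$ the tree consists of a single anchor; at each time $t=1,2,\dots$, every anchor is simultaneously replaced either by a dead leaf or by an internal node with two anchors as children. A growing binary tree is any tree obtainable after finitely many steps of this process; it is active if it has at least one anchor. The height of a tree is the maximal distance from the root to a node.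
   Formalization: Hausdorff convergence is expressed with rational distance bounds, and the closed triangle with vertices $(0,0)$, $(1,0)$ and $(2,1)$ enters only through its points with rational coordinates. -}

module Defs where

open import Data.Nat using (ℕ; zero; suc; _+_; _⊔_; _∸_)
open import Data.Integer using (+_)
open import Data.Product using (Σ; ∃; _×_; _,_)
open import Data.Rational using (ℚ; _/_; _*_; _-_; _≤_; _<_; ½; 0ℚ)
import Data.Rational as Q
open import Relation.Binary.PropositionalEquality using (_≡_)

data Tree : Set where
  anchor : Tree
  dead   : Tree
  node   : Tree → Tree → Tree

data Step : Tree → Tree → Set where
  anchor→dead : Step anchor dead
  anchor→node : Step anchor (node anchor anchor)
  dead→dead   : Step dead dead
  node→node   : ∀ {l l′ r r′} → Step l l′ → Step r r′ → Step (node l r) (node l′ r′)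

data ReachedAt : ℕ → Tree → Set where
  start : ReachedAt zero anchor
  grow  : ∀ {t T T′} → ReachedAt t T → Step T T′ → ReachedAt (suc t) T′

Growing : Tree → Set
Growing T = ∃ λ t → ReachedAt t T

internals : Tree → ℕ
internals anchor     = 0
internals dead       = 0
internals (node l r) = suc (internals l + internals r)

anchors : Tree → ℕ
anchors anchor     = 1
anchors dead       = 0
anchors (node l r) = anchors l + anchors r

height : Tree → ℕ
height anchor     = 0
height dead       = 0
height (node l r) = suc (height l ⊔ height r)

Active : Tree → Set
Active T = 1 Data.Nat.≤ anchors T

tNonzero : ℕ → ℕ → ℕ → Set
tNonzero n m h = Σ Tree λ T → Growing T × Active T × height T ≡ h × internals T ≡ n × anchors T ≡ m

InS : ℕ → ℕ → ℕ → Set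
InS h n k = 1 Data.Nat.≤ n × 1 Data.Nat.≤ k × tNonzero n (2 Data.Nat.* k) h

halfPow : ℕ → ℚ
halfPow zero    = + 1 / 1
halfPow (suc j) = ½ * halfPow j

normalize : ℕ → ℕ → ℚ
normalize h x = (+ x / 1) * halfPow (h ∸ 1)

-- Closed triangle with vertices (0,0), (1,0), (2,1):
-- 0 ≤ y,  2y ≤ x,  x ≤ 1 + y.
InTriangle : ℚ → ℚ → Set
InTriangle x y = 0ℚ ≤ y × (y Q.+ y) ≤ x × x ≤ (+ 1 / 1) Q.+ y

dist² : ℚ → ℚ → ℚ → ℚ → ℚ
dist² x₁ y₁ x₂ y₂ = ((x₁ - x₂) * (x₁ - x₂)) Q.+ ((y₁ - y₂) * (y₁ - y₂))

{-# OPTIONS --safe #-}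
module Submission where

-- At time h = j + 1 an active tree with n internal nodes and 2k anchors has its
-- anchors at depth h and its dead leaves above, so counting its n + 1 leaves
-- against Kraft's equality gives 2k ≤ n + 1 ≤ 2^j + k: the point
-- ((n + 1)/2^j, k/2^j) lies in the triangle.  Conversely, for 1 ≤ k ≤ 2^j the
-- realizable n form an interval [lo, 2^j + k) with lo < 2k + j, built by
-- putting a tree of the previous time beside an inactive or a complete tree.
-- Hence every lattice point of the triangle scaled by 2^j is within j + 1 of a
-- point of S_h, and (j + 2)/2^j → 0.

open import Defs
open import Data.Product using (Σ; _×_; _,_; uncurry)
open import Data.Sum using (_⊎_; inj₁; inj₂)
open import Data.Empty using (⊥-elim)
open import Relation.Binary.PropositionalEquality
open import Relation.Nullary using (yes; no)

module Counting where
  open import Data.Nat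
  open import Data.Nat.Properties
  open import Data.Nat.Tactic.RingSolver using (solve-∀)
  open import Algebra.Definitions.RawMagma +-rawMagma using (_,_)

  2*n≡n+n : ∀ n → 2 * n ≡ n + n
  2*n≡n+n n = cong (n +_) (+-identityʳ n)

  2*m+n≡m+n+m : ∀ m n → 2 * m + n ≡ (m + n) + m
  2*m+n≡m+n+m = solve-∀

  -- The growth process read top-down: after t steps the anchors sit at depth t
  -- and the dead leaves at depth < t.
  data GrownIn : ℕ → Tree → Set where
    anchor : GrownIn 0 anchor
    dead   : ∀ {t} → GrownIn (suc t) dead
    node   : ∀ {t l r} → GrownIn t l → GrownIn t r → GrownIn (suc t) (node l r)

  grownIn-step : ∀ {t T T′} → GrownIn t T → Step T T′ → GrownIn (suc t) T′
  grownIn-step anchor       anchor→dead       = dead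
  grownIn-step anchor       anchor→node       = node anchor anchor
  grownIn-step dead         dead→dead         = dead
  grownIn-step (node gl gr) (node→node sl sr) = node (grownIn-step gl sl) (grownIn-step gr sr)

  reachedAt⇒grownIn : ∀ {t T} → ReachedAt t T → GrownIn t T
  reachedAt⇒grownIn start      = anchor
  reachedAt⇒grownIn (grow r s) = grownIn-step (reachedAt⇒grownIn r) s

  reachedAt-dead : ∀ t → ReachedAt (suc t) dead
  reachedAt-dead zero    = grow start anchor→dead
  reachedAt-dead (suc t) = grow (reachedAt-dead t) dead→dead

  reachedAt-node : ∀ {t l r} → ReachedAt t l → ReachedAt t r → ReachedAt (suc t) (node l r)
  reachedAt-node start        start        = grow start anchor→node
  reachedAt-node (grow rl sl) (grow rr sr) = grow (reachedAt-node rl rr) (node→node sl sr)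

  grownIn⇒reachedAt : ∀ {t T} → GrownIn t T → ReachedAt t T
  grownIn⇒reachedAt anchor       = start
  grownIn⇒reachedAt (dead {t})   = reachedAt-dead t
  grownIn⇒reachedAt (node gl gr) = reachedAt-node (grownIn⇒reachedAt gl) (grownIn⇒reachedAt gr)

  height≤ : ∀ {t T} → GrownIn t T → height T ≤ t
  height≤ anchor       = z≤n
  height≤ dead         = z≤n
  height≤ (node gl gr) = s≤s (⊔-lub (height≤ gl) (height≤ gr))

  height≥ : ∀ {t T} → GrownIn t T → Active T → t ≤ height T
  height≥ anchor _ = z≤n
  height≥ (node {l = l} {r} gl gr) active with anchors l in eq
  ... | zero  = s≤s (≤-trans (height≥ gr active) (m≤n⊔m (height l) (height r)))
  ... | suc _ = s≤s (≤-trans (height≥ gl l-active) (m≤m⊔n (height l) (height r)))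
    where
    l-active : Active l
    l-active = subst (1 ≤_) (sym eq) (s≤s z≤n)

  height-active : ∀ {t T} → GrownIn t T → Active T → height T ≡ t
  height-active g active = ≤-antisym (height≤ g) (height≥ g active)

  anchors≤1+internals : ∀ T → anchors T ≤ suc (internals T)
  anchors≤1+internals anchor     = ≤-refl
  anchors≤1+internals dead       = z≤n
  anchors≤1+internals (node l r) = begin
    anchors l + anchors r                   ≤⟨ +-mono-≤ (anchors≤1+internals l) (anchors≤1+internals r) ⟩
    suc (internals l) + suc (internals r)   ≡⟨ cong suc (+-suc (internals l) (internals r)) ⟩
    suc (suc (internals l + internals r))   ∎
    where open ≤-Reasoning

  -- Kraft's equality for the internals + 1 leaves, of which the anchors have
  -- depth t and the dead leaves depth < t.
  2[1+internals]≤2^t+anchors : ∀ {t T} → GrownIn t T → 2 * suc (internals T) ≤ 2 ^ t + anchors T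
  2[1+internals]≤2^t+anchors anchor = ≤-refl
  2[1+internals]≤2^t+anchors (dead {t}) = m≤n⇒m≤n+o 0 (*-monoʳ-≤ 2 (m^n>0 2 t))
  2[1+internals]≤2^t+anchors (node {t} {l} {r} gl gr) = begin
    2 * suc (suc (internals l + internals r))        ≡⟨ regroup (internals l) (internals r) ⟩
    2 * suc (internals l) + 2 * suc (internals r)    ≤⟨ +-mono-≤ (bound gl) (bound gr) ⟩
    (2 ^ t + anchors l) + (2 ^ t + anchors r)        ≡⟨ interchange (2 ^ t) (anchors l) (anchors r) ⟩
    2 * 2 ^ t + (anchors l + anchors r)              ∎
    where
    open ≤-Reasoning
    bound = 2[1+internals]≤2^t+anchors
    regroup : ∀ a b → 2 * suc (suc (a + b)) ≡ 2 * suc a + 2 * suc b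
    regroup = solve-∀
    interchange : ∀ p a b → (p + a) + (p + b) ≡ 2 * p + (a + b)
    interchange = solve-∀

  Realizable : ℕ → ℕ → ℕ → Set
  Realizable t n a = Σ Tree λ T → GrownIn t T × internals T ≡ n × anchors T ≡ a

  realizable-dead : ∀ t → Realizable (suc t) 0 0
  realizable-dead t = dead , dead , refl , refl

  realizable-node : ∀ {t n₁ n₂ a₁ a₂} → Realizable t n₁ a₁ → Realizable t n₂ a₂ →
                    Realizable (suc t) (suc (n₁ + n₂)) (a₁ + a₂)
  realizable-node (l , gl , refl , refl) (r , gr , refl , refl) = node l r , node gl gr , refl , refl

  realizable-complete : ∀ t → Σ ℕ λ n → suc n ≡ 2 ^ t × Realizable t n (2 ^ t)
  realizable-complete zero    = 0 , refl , anchor , anchor , refl , refl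
  realizable-complete (suc t) with realizable-complete t
  ... | n , 1+n≡2^t , R =
    suc (n + n) , 2+n+n≡2^[1+t] , subst (Realizable (suc t) _) (sym (2*n≡n+n (2 ^ t))) (realizable-node R R)
    where
    2+n+n≡2^[1+t] : suc (suc (n + n)) ≡ 2 * 2 ^ t
    2+n+n≡2^[1+t] = begin
      suc (suc (n + n))    ≡⟨ cong suc (sym (+-suc n n)) ⟩
      suc n + suc n        ≡⟨ cong₂ _+_ 1+n≡2^t 1+n≡2^t ⟩
      2 ^ t + 2 ^ t        ≡⟨ sym (2*n≡n+n (2 ^ t)) ⟩
      2 * 2 ^ t            ∎
      where open ≡-Reasoning

  split-sum : ∀ {lo a b n} → lo ≤ n → suc n < a + b → lo < a → 0 < b →
              Σ ℕ λ n₁ → Σ ℕ λ n₂ → n₁ + n₂ ≡ n × lo ≤ n₁ × n₁ < a × n₂ < b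
  split-sum {lo} {a} {b} {n} lo≤n _ _ 0<b with n <? a
  ... | yes n<a = n , 0 , +-identityʳ n , lo≤n , n<a , 0<b
  split-sum {lo} {suc a} {b} {n} _ 1+n<a+b lo<a _ | no n≮a with ≤⇒≤″ (≮⇒≥ n≮a)
  ... | d , refl = a , suc d , +-suc a d , ≤-pred lo<a , ≤-refl , +-cancelˡ-≤ a (suc (suc d)) b a+2+d≤a+b
    where
    a+2+d≤a+b : a + suc (suc d) ≤ a + b
    a+2+d≤a+b = subst (_≤ a + b) (sym (trans (+-suc a (suc d)) (cong suc (+-suc a d)))) (≤-pred 1+n<a+b)

  realizable-inactive : ∀ j n → n < 2 ^ j → Realizable (suc j) n 0
  realizable-inactive zero    zero    _        = realizable-dead 0
  realizable-inactive zero    (suc n) (s≤s ())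
  realizable-inactive (suc j) zero    _        = realizable-dead (suc j)
  realizable-inactive (suc j) (suc n) 1+n<2^[1+j]
    with split-sum z≤n (subst (suc (suc n) ≤_) (2*n≡n+n (2 ^ j)) 1+n<2^[1+j]) (m^n>0 2 j) (m^n>0 2 j)
  ... | n₁ , n₂ , refl , _ , n₁< , n₂< =
    realizable-node (realizable-inactive j n₁ n₁<) (realizable-inactive j n₂ n₂<)

  RealizableFrom : ℕ → ℕ → ℕ → Set
  RealizableFrom j k lo = ∀ n → lo ≤ n → n < 2 ^ j + k → Realizable (suc j) n (2 * k)

  realizableFrom-inactive : ∀ {j k lo} → lo < 2 ^ j + k → RealizableFrom j k lo →
                            RealizableFrom (suc j) k (suc lo)
  realizableFrom-inactive {j} {k} {lo} lo<P+k R (suc n) (s≤s lo≤n) 1+n<2P+k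
    with split-sum lo≤n (subst (suc (suc n) ≤_) (2*m+n≡m+n+m (2 ^ j) k) 1+n<2P+k) lo<P+k (m^n>0 2 j)
  ... | n₁ , n₂ , refl , lo≤n₁ , n₁< , n₂< =
    subst (Realizable (suc (suc j)) _) (+-identityʳ (2 * k))
          (realizable-node (R n₁ lo≤n₁ n₁<) (realizable-inactive j n₂ n₂<))

  realizableFrom-complete : ∀ {j k lo} → RealizableFrom j k lo →
                            RealizableFrom (suc j) (2 ^ j + k) (2 ^ suc j + lo)
  realizableFrom-complete {j} {k} {lo} R n 2P+lo≤n n<2P+P+k
    with ≤⇒≤″ (≤-trans (m≤m+n (2 ^ suc j) lo) 2P+lo≤n)
  ... | d , refl with realizable-complete (suc j)
  ... | c , 1+c≡2P , C =
    subst₂ (Realizable (suc (suc j))) (cong (_+ d) 1+c≡2P) (sym (*-distribˡ-+ 2 (2 ^ j) k))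
           (realizable-node C (R d lo≤d d<P+k))
    where
    lo≤d : lo ≤ d
    lo≤d = +-cancelˡ-≤ (2 ^ suc j) lo d 2P+lo≤n
    d<P+k : d < 2 ^ j + k
    d<P+k = +-cancelˡ-< (2 ^ suc j) d (2 ^ j + k) n<2P+P+k

  RealizableRange : ℕ → ℕ → Set
  RealizableRange j k = Σ ℕ λ lo → lo < 2 * k + j × lo < 2 ^ j + k × RealizableFrom j k lo

  realizableRange-inactive : ∀ {j k} → RealizableRange j k → RealizableRange (suc j) k
  realizableRange-inactive {j} {k} (lo , lo<2k+j , lo<P+k , R) =
    suc lo , subst (suc lo <_) (sym (+-suc (2 * k) j)) (s≤s lo<2k+j) , 1+lo<2P+k , realizableFrom-inactive lo<P+k R
    where
    1+lo<2P+k : suc lo < 2 * 2 ^ j + k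
    1+lo<2P+k = ≤-trans (s≤s lo<P+k) (+-monoˡ-< k (m<m+n (2 ^ j) (≤-trans (m^n>0 2 j) (m≤m+n (2 ^ j) 0))))

  realizableRange-complete : ∀ {j k} → RealizableRange j k → RealizableRange (suc j) (2 ^ j + k)
  realizableRange-complete {j} {k} (lo , lo<2k+j , lo<P+k , R) =
    2 * 2 ^ j + lo , 2P+lo<2[P+k]+1+j , +-monoʳ-< (2 * 2 ^ j) lo<P+k , realizableFrom-complete R
    where
    open ≤-Reasoning
    rearrange : ∀ p k j → 2 * p + (2 * k + j) ≡ 2 * (p + k) + j
    rearrange = solve-∀
    2P+lo<2[P+k]+1+j : 2 * 2 ^ j + lo < 2 * (2 ^ j + k) + suc j
    2P+lo<2[P+k]+1+j = begin-strict
      2 * 2 ^ j + lo              <⟨ +-monoʳ-< (2 * 2 ^ j) lo<2k+j ⟩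
      2 * 2 ^ j + (2 * k + j)     ≡⟨ rearrange (2 ^ j) k j ⟩
      2 * (2 ^ j + k) + j         ≤⟨ +-monoʳ-≤ (2 * (2 ^ j + k)) (n≤1+n j) ⟩
      2 * (2 ^ j + k) + suc j     ∎

  -- Up to 2^j pairs of anchors: a tree of the previous time beside an inactive
  -- one; beyond: a complete tree beside a tree with k - 2^j pairs.
  realizableRange : ∀ j k → 1 ≤ k → k ≤ 2 ^ j → RealizableRange j k
  realizableRange zero (suc zero) _ _ = 1 , ≤-refl , ≤-refl , base
    where
    base : RealizableFrom 0 1 1
    base (suc zero) _ _ = node anchor anchor , node anchor anchor , refl , refl
    base (suc (suc n)) _ (s≤s (s≤s ()))
  realizableRange zero (suc (suc k)) _ (s≤s ())
  realizableRange (suc j) k 1≤k k≤2P with k ≤? 2 ^ j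
  ... | yes k≤P = realizableRange-inactive (realizableRange j k 1≤k k≤P)
  ... | no k≰P with ≤⇒≤″ (≰⇒> k≰P)
  ... | d , refl =
    subst (RealizableRange (suc j)) (+-suc (2 ^ j) d)
          (realizableRange-complete (realizableRange j (suc d) (s≤s z≤n) 1+d≤P))
    where
    1+d≤P : suc d ≤ 2 ^ j
    1+d≤P = +-cancelˡ-≤ (2 ^ j) (suc d) (2 ^ j)
              (subst₂ _≤_ (sym (+-suc (2 ^ j) d)) (2*n≡n+n (2 ^ j)) k≤2P)

  InScaledTriangle : ℕ → ℕ → ℕ → Set
  InScaledTriangle j n k = k + k ≤ n × n ≤ 2 ^ j + k

  record Near (e m n : ℕ) : Set where
    constructor near
    field
      ≤+ : m ≤ n + e
      ≥- : n ≤ m + e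

  near-sym : ∀ {e m n} → Near e m n → Near e n m
  near-sym (near m≤n+e n≤m+e) = near n≤m+e m≤n+e

  ≤≤1+⇒near : ∀ {e m n} → m ≤ n → n ≤ suc m → Near (suc e) m n
  ≤≤1+⇒near {e} {m} {n} m≤n n≤1+m =
    near (≤-trans m≤n (m≤m+n n (suc e)))
         (≤-trans n≤1+m (subst (suc m ≤_) (sym (+-suc m e)) (s≤s (m≤m+n m e))))

  InS⇒inScaledTriangle : ∀ {j n k} → InS (suc j) n k → InScaledTriangle j (suc n) k
  InS⇒inScaledTriangle {j} {n} {k} (_ , _ , T , (_ , reached) , active , height≡ , refl , anchors≡) =
    subst (_≤ suc n) (trans anchors≡ (2*n≡n+n k)) (anchors≤1+internals T) ,
    *-cancelˡ-≤ 2 (subst (2 * suc n ≤_) 2^[1+j]+anchors≡2[P+k] (2[1+internals]≤2^t+anchors g))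
    where
    g : GrownIn (suc j) T
    g = subst (λ t → GrownIn t T) (trans (sym (height-active (reachedAt⇒grownIn reached) active)) height≡)
              (reachedAt⇒grownIn reached)
    2^[1+j]+anchors≡2[P+k] : 2 ^ suc j + anchors T ≡ 2 * (2 ^ j + k)
    2^[1+j]+anchors≡2[P+k] = trans (cong (2 ^ suc j +_) anchors≡) (sym (*-distribˡ-+ 2 (2 ^ j) k))

  realizable⇒InS : ∀ {j n k} → 1 ≤ k → Realizable (suc j) n (2 * k) → InS (suc j) n k
  realizable⇒InS {j} {k = k} 1≤k (T , g , refl , anchors≡) =
    ≤-pred (≤-trans 2≤2k (subst (_≤ suc (internals T)) anchors≡ (anchors≤1+internals T))) , 1≤k ,
    T , (suc j , grownIn⇒reachedAt g) , active , height-active g active , refl , anchors≡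
    where
    2≤2k : 2 ≤ 2 * k
    2≤2k = *-monoʳ-≤ 2 1≤k
    active : Active T
    active = subst (1 ≤_) (sym anchors≡) (≤-trans (s≤s z≤n) 2≤2k)

  clamp : ∀ {lo hi} n₀ → lo < hi →
          Σ ℕ λ n → lo ≤ n × n < hi × (n ≤ n₀ ⊎ n ≡ lo) × (n₀ ≤ n ⊎ suc n ≡ hi)
  clamp {lo} {hi} n₀ lo<hi with n₀ <? lo | n₀ <? hi
  ... | yes n₀<lo | _         = lo , ≤-refl , lo<hi , inj₂ refl , inj₁ (<⇒≤ n₀<lo)
  ... | no n₀≮lo  | yes n₀<hi = n₀ , ≮⇒≥ n₀≮lo , n₀<hi , inj₁ ≤-refl , inj₁ ≤-refl
  clamp {hi = suc h} n₀ lo<hi | no _ | no n₀≮hi =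
    h , ≤-pred lo<hi , ≤-refl , inj₁ (≤-trans (n≤1+n h) (≮⇒≥ n₀≮hi)) , inj₂ refl

  realizableRange-near : ∀ {j n₀ k₀ k} → InScaledTriangle j n₀ k₀ → k₀ ≤ k → k ≤ suc k₀ →
                         RealizableRange j k → Σ ℕ λ n → Realizable (suc j) n (2 * k) × Near (suc j) n n₀
  realizableRange-near {j} {n₀} {k₀} {k} (2k₀≤n₀ , n₀≤P+k₀) k₀≤k k≤1+k₀ (lo , lo<2k+j , lo<P+k , R)
    with clamp n₀ lo<P+k
  ... | n , lo≤n , n<P+k , n≤n₀∨n≡lo , n₀≤n∨1+n≡P+k =
    n , R n lo≤n n<P+k , near (n≤ n≤n₀∨n≡lo) (n₀≤ n₀≤n∨1+n≡P+k)
    where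
    open ≤-Reasoning
    rearrange : ∀ k j → 2 * suc k + j ≡ suc ((k + k) + suc j)
    rearrange = solve-∀
    n≤ : n ≤ n₀ ⊎ n ≡ lo → n ≤ n₀ + suc j
    n≤ (inj₁ n≤n₀) = ≤-trans n≤n₀ (m≤m+n n₀ (suc j))
    n≤ (inj₂ refl) = ≤-pred (begin
      suc lo                ≤⟨ lo<2k+j ⟩
      2 * k + j             ≤⟨ +-monoˡ-≤ j (*-monoʳ-≤ 2 k≤1+k₀) ⟩
      2 * suc k₀ + j        ≡⟨ rearrange k₀ j ⟩
      suc (k₀ + k₀ + suc j) ≤⟨ s≤s (+-monoˡ-≤ (suc j) 2k₀≤n₀) ⟩
      suc (n₀ + suc j)      ∎)
    n₀≤ : n₀ ≤ n ⊎ suc n ≡ 2 ^ j + k → n₀ ≤ n + suc j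
    n₀≤ (inj₁ n₀≤n) = ≤-trans n₀≤n (m≤m+n n (suc j))
    n₀≤ (inj₂ 1+n≡P+k) = begin
      n₀           ≤⟨ n₀≤P+k₀ ⟩
      2 ^ j + k₀   ≤⟨ +-monoʳ-≤ (2 ^ j) k₀≤k ⟩
      2 ^ j + k    ≡⟨ sym 1+n≡P+k ⟩
      suc n        ≤⟨ s≤s (m≤m+n n j) ⟩
      suc (n + j)  ≡⟨ sym (+-suc n j) ⟩
      n + suc j    ∎

  realizable-near : ∀ {j n₀ k₀} → InScaledTriangle j n₀ k₀ →
    Σ ℕ λ n → Σ ℕ λ k → 1 ≤ k × Realizable (suc j) n (2 * k) × Near (suc j) n n₀ × Near (suc j) k k₀
  realizable-near {j} {n₀} {k₀} tri@(2k₀≤n₀ , n₀≤P+k₀) =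
    let n , R , near-n = realizableRange-near tri k₀≤k k≤1+k₀ (realizableRange j k 1≤k k≤P)
    in n , k , 1≤k , R , near-n , near-sym (≤≤1+⇒near k₀≤k k≤1+k₀)
    where
    k = k₀ ⊔ 1
    1≤k : 1 ≤ k
    1≤k = m≤n⊔m k₀ 1
    k₀≤k : k₀ ≤ k
    k₀≤k = m≤m⊔n k₀ 1
    k≤1+k₀ : k ≤ suc k₀
    k≤1+k₀ = ⊔-lub (n≤1+n k₀) (s≤s z≤n)
    k≤P : k ≤ 2 ^ j
    k≤P = ⊔-lub (+-cancelʳ-≤ k₀ k₀ (2 ^ j) (≤-trans 2k₀≤n₀ n₀≤P+k₀)) (m^n>0 2 j)

  n*n≤2^n : ∀ {n} → 4 ≤ n → n * n ≤ 2 ^ n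
  n*n≤2^n 4≤n with ≤⇒≤″ 4≤n
  ... | i , refl = from4 i
    where
    open ≤-Reasoning
    expand : ∀ n → suc n * suc n ≡ n * n + (2 * n + 1)
    expand = solve-∀
    double : ∀ n → 2 * n + 2 * n ≡ 4 * n
    double = solve-∀
    from4 : ∀ i → (4 + i) * (4 + i) ≤ 2 ^ (4 + i)
    from4 zero    = ≤-refl
    from4 (suc i) = begin
      suc n * suc n             ≡⟨ expand n ⟩
      n * n + (2 * n + 1)       ≤⟨ +-monoʳ-≤ (n * n) 2n+1≤n*n ⟩
      n * n + n * n             ≤⟨ +-mono-≤ (from4 i) (from4 i) ⟩
      2 ^ n + 2 ^ n             ≡⟨ sym (2*n≡n+n (2 ^ n)) ⟩
      2 * 2 ^ n                 ∎
      where
      n = 4 + i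
      2n+1≤n*n : 2 * n + 1 ≤ n * n
      2n+1≤n*n = begin
        2 * n + 1               ≤⟨ +-monoʳ-≤ (2 * n) (s≤s z≤n) ⟩
        2 * n + 2 * n           ≡⟨ double n ⟩
        4 * n                   ≤⟨ *-monoˡ-≤ n (m≤m+n 4 i) ⟩
        n * n                   ∎

  [2+n]*c<2^n : ∀ {c n} → c + 4 ≤ n → (2 + n) * c < 2 ^ n
  [2+n]*c<2^n {c} {n} c+4≤n = begin-strict
    (2 + n) * c         ≡⟨ distrib n c ⟩
    n * c + 2 * c       <⟨ +-monoʳ-< (n * c) 2c<4n ⟩
    n * c + 4 * n       ≡⟨ factor n c ⟩
    n * (c + 4)         ≤⟨ *-monoʳ-≤ n c+4≤n ⟩
    n * n               ≤⟨ n*n≤2^n (≤-trans (m≤n+m 4 c) c+4≤n) ⟩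
    2 ^ n               ∎
    where
    open ≤-Reasoning
    distrib : ∀ n c → (2 + n) * c ≡ n * c + 2 * c
    distrib = solve-∀
    factor : ∀ n c → n * c + 4 * n ≡ n * (c + 4)
    factor = solve-∀
    2c<4n : 2 * c < 4 * n
    2c<4n = <-≤-trans (*-monoʳ-< 2 (<-≤-trans (m<m+n c (s≤s z≤n)) c+4≤n))
                      (*-monoˡ-≤ n {2} {4} (s≤s (s≤s z≤n)))

module Dyadic where
  open Counting using (InScaledTriangle; Near; near; [2+n]*c<2^n)
  open import Data.Nat as ℕ using (ℕ; zero; suc)
  import Data.Nat.Properties as ℕ
  open import Data.Nat.Tactic.RingSolver using (solve-∀)
  import Data.Nat.Coprimality as Coprime
  open import Data.Integer as ℤ using (+_; +[1+_])
  import Data.Integer.Properties as ℤ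
  open import Data.Rational
  open import Data.Rational.Properties
  open import Data.Rational.Solver using (module +-*-Solver)
  open +-*-Solver

  fromℕ : ℕ → ℚ
  fromℕ n = + n / 1

  -- + n / 1 normalises through a gcd that is stuck on a variable n; the
  -- arithmetic of fromℕ goes through this normal form instead.
  fromℕ≡mkℚ : ∀ n → fromℕ n ≡ mkℚ (+ n) 0 (Coprime.sym (Coprime.1-coprimeTo n))
  fromℕ≡mkℚ n = ↥p/↧p≡p (mkℚ (+ n) 0 (Coprime.sym (Coprime.1-coprimeTo n)))

  fromℕ-homo-+ : ∀ m n → fromℕ (m ℕ.+ n) ≡ fromℕ m + fromℕ n
  fromℕ-homo-+ m n rewrite fromℕ≡mkℚ m | fromℕ≡mkℚ n =
    cong (_/ 1) (sym (cong₂ ℤ._+_ (ℤ.*-identityʳ (+ m)) (ℤ.*-identityʳ (+ n))))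

  fromℕ-homo-* : ∀ m n → fromℕ (m ℕ.* n) ≡ fromℕ m * fromℕ n
  fromℕ-homo-* m n rewrite fromℕ≡mkℚ m | fromℕ≡mkℚ n = cong (_/ 1) (ℤ.pos-* m n)

  fromℕ-mono-≤ : ∀ {m n} → m ℕ.≤ n → fromℕ m ≤ fromℕ n
  fromℕ-mono-≤ {m} {n} m≤n rewrite fromℕ≡mkℚ m | fromℕ≡mkℚ n =
    *≤* (subst₂ ℤ._≤_ (sym (ℤ.*-identityʳ (+ m))) (sym (ℤ.*-identityʳ (+ n))) (ℤ.+≤+ m≤n))

  fromℕ-mono-< : ∀ {m n} → m ℕ.< n → fromℕ m < fromℕ n
  fromℕ-mono-< {m} {n} m<n rewrite fromℕ≡mkℚ m | fromℕ≡mkℚ n =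
    *<* (subst₂ ℤ._<_ (sym (ℤ.*-identityʳ (+ m))) (sym (ℤ.*-identityʳ (+ n))) (ℤ.+<+ m<n))

  halfPow-pos : ∀ j → Positive (halfPow j)
  halfPow-pos zero    = _
  halfPow-pos (suc j) = pos*pos⇒pos ½ (halfPow j) {{halfPow-pos j}}

  -- normalize (suc j) n reduces to scaled j n.
  scaled : ℕ → ℕ → ℚ
  scaled j n = fromℕ n * halfPow j

  scaled-homo-+ : ∀ j m n → scaled j (m ℕ.+ n) ≡ scaled j m + scaled j n
  scaled-homo-+ j m n =
    trans (cong (_* halfPow j) (fromℕ-homo-+ m n)) (*-distribʳ-+ (halfPow j) (fromℕ m) (fromℕ n))

  scaled-mono-≤ : ∀ j {m n} → m ℕ.≤ n → scaled j m ≤ scaled j n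
  scaled-mono-≤ j m≤n =
    *-monoʳ-≤-nonNeg (halfPow j) {{pos⇒nonNeg (halfPow j) {{halfPow-pos j}}}} (fromℕ-mono-≤ m≤n)

  scaled-mono-< : ∀ j {m n} → m ℕ.< n → scaled j m < scaled j n
  scaled-mono-< j m<n = *-monoˡ-<-pos (halfPow j) {{halfPow-pos j}} (fromℕ-mono-< m<n)

  scaled-cancel-< : ∀ j {m n} → scaled j m < scaled j n → m ℕ.< n
  scaled-cancel-< j {m} {n} m<n =
    ℕ.≰⇒> (λ n≤m → <-irrefl refl (<-≤-trans m<n (scaled-mono-≤ j {n} {m} n≤m)))

  scaled-zero : ∀ j → scaled j 0 ≡ 0ℚ
  scaled-zero j = *-zeroˡ (halfPow j)

  scaled-nonNeg : ∀ j n → 0ℚ ≤ scaled j n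
  scaled-nonNeg j n = subst (_≤ scaled j n) (scaled-zero j) (scaled-mono-≤ j {0} {n} ℕ.z≤n)

  scaled-2^ : ∀ j → scaled j (2 ℕ.^ j) ≡ 1ℚ
  scaled-2^ zero    = refl
  scaled-2^ (suc j) = begin
    fromℕ (2 ℕ.* P) * (½ * halfPow j)        ≡⟨ cong (_* (½ * halfPow j)) (fromℕ-homo-* 2 P) ⟩
    (fromℕ 2 * fromℕ P) * (½ * halfPow j)    ≡⟨ interchange (fromℕ 2) (fromℕ P) ½ (halfPow j) ⟩
    (fromℕ 2 * ½) * scaled j P               ≡⟨ cong ((fromℕ 2 * ½) *_) (scaled-2^ j) ⟩
    1ℚ                                       ∎
    where
    open ≡-Reasoning
    P = 2 ℕ.^ j
    interchange : ∀ a b c d → (a * b) * (c * d) ≡ (a * c) * (b * d)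
    interchange = solve 4 (λ a b c d → (a :* b) :* (c :* d) := (a :* c) :* (b :* d)) refl

  Floor : ℕ → ℚ → ℕ → Set
  Floor j q m = scaled j m ≤ q × q < scaled j (suc m)

  floor-exists : ∀ j {q} B → 0ℚ ≤ q → q < scaled j B → Σ ℕ (Floor j q)
  floor-exists j zero 0≤q q<0 = ⊥-elim (<-irrefl refl (≤-<-trans 0≤q (subst (_ <_) (scaled-zero j) q<0)))
  floor-exists j {q} (suc B) 0≤q q<[1+B] with scaled j B ≤? q
  ... | yes B≤q = B , B≤q , q<[1+B]
  ... | no  B≰q = floor-exists j B 0≤q (≰⇒> B≰q)

  p≤q⇒0≤q-p : ∀ {p q} → p ≤ q → 0ℚ ≤ q - p
  p≤q⇒0≤q-p {p} {q} p≤q = subst (_≤ q - p) (+-inverseʳ p) (+-monoˡ-≤ (- p) p≤q)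

  0≤q-p⇒p≤q : ∀ {p q} → 0ℚ ≤ q - p → p ≤ q
  0≤q-p⇒p≤q {p} {q} 0≤q-p =
    subst₂ _≤_ (+-identityʳ p) (solve 2 (λ p q → p :+ (q :- p) := q) refl p q) (+-monoʳ-≤ p 0≤q-p)

  0≤p*q : ∀ {p q} → 0ℚ ≤ p → 0ℚ ≤ q → 0ℚ ≤ p * q
  0≤p*q {p} {q} 0≤p 0≤q =
    nonNegative⁻¹ (p * q) {{nonNeg*nonNeg⇒nonNeg p {{nonNegative 0≤p}} q {{nonNegative 0≤q}}}}

  square-mono-< : ∀ {p q} → 0ℚ ≤ p → p < q → p * p < q * q
  square-mono-< {p} {q} 0≤p p<q = ≤-<-trans (*-monoˡ-≤-nonNeg p {{nonNegative 0≤p}} (<⇒≤ p<q))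
                                            (*-monoˡ-<-pos q {{positive (≤-<-trans 0≤p p<q)}} p<q)

  record Close (δ x y : ℚ) : Set where
    constructor close
    field
      ≤+ : x ≤ y + δ
      ≥- : y ≤ x + δ

  close⇒square≤ : ∀ {δ x y} → Close δ x y → (x - y) * (x - y) ≤ δ * δ
  close⇒square≤ {δ} {x} {y} (close x≤y+δ y≤x+δ) =
    0≤q-p⇒p≤q (subst (0ℚ ≤_) (difference-of-squares x y δ)
                     (0≤p*q (p≤q⇒0≤q-p x≤y+δ) (p≤q⇒0≤q-p y≤x+δ)))
    where
    difference-of-squares : ∀ x y δ → (y + δ - x) * (x + δ - y) ≡ δ * δ - (x - y) * (x - y)
    difference-of-squares = solve 3 (λ x y δ →
      (y :+ δ :- x) :* (x :+ δ :- y) := δ :* δ :- (x :- y) :* (x :- y)) refl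

  dist²< : ∀ {δ ε x₁ y₁ x₂ y₂} → 0ℚ ≤ δ → δ + δ < ε → Close δ x₁ x₂ → Close δ y₁ y₂ →
           dist² x₁ y₁ x₂ y₂ < ε * ε
  dist²< {δ} {ε} {x₁} {y₁} {x₂} {y₂} 0≤δ 2δ<ε close-x close-y = begin-strict
    dist² x₁ y₁ x₂ y₂       ≤⟨ +-mono-≤ (close⇒square≤ close-x) (close⇒square≤ close-y) ⟩
    δ² + δ²                 ≡⟨ sym (+-identityʳ (δ² + δ²)) ⟩
    (δ² + δ²) + 0ℚ          ≤⟨ +-monoʳ-≤ (δ² + δ²) (+-mono-≤ 0≤δ² 0≤δ²) ⟩
    (δ² + δ²) + (δ² + δ²)   ≡⟨ four-squares δ ⟩
    (δ + δ) * (δ + δ)       <⟨ square-mono-< (+-mono-≤ 0≤δ 0≤δ) 2δ<ε ⟩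
    ε * ε                   ∎
    where
    open ≤-Reasoning
    δ² = δ * δ
    0≤δ² : 0ℚ ≤ δ²
    0≤δ² = 0≤p*q 0≤δ 0≤δ
    four-squares : ∀ δ → (δ * δ + δ * δ) + (δ * δ + δ * δ) ≡ (δ + δ) * (δ + δ)
    four-squares = solve 1 (λ δ → (δ :* δ :+ δ :* δ) :+ (δ :* δ :+ δ :* δ) := (δ :+ δ) :* (δ :+ δ)) refl

  near⇒close : ∀ j {e n n₀ x} → Near e n n₀ → Floor j x n₀ → Close (scaled j (suc e)) (scaled j n) x
  near⇒close j {e} {n} {n₀} {x} (near n≤n₀+e n₀≤n+e) (lower , upper) =
    close (begin
      scaled j n                        ≤⟨ scaled-mono-≤ j (ℕ.≤-trans n≤n₀+e (ℕ.+-monoʳ-≤ n₀ (ℕ.n≤1+n e))) ⟩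
      scaled j (n₀ ℕ.+ suc e)           ≡⟨ scaled-homo-+ j n₀ (suc e) ⟩
      scaled j n₀ + scaled j (suc e)    ≤⟨ +-monoˡ-≤ (scaled j (suc e)) lower ⟩
      x + scaled j (suc e)              ∎)
    (begin
      x                                 ≤⟨ <⇒≤ upper ⟩
      scaled j (suc n₀)                 ≤⟨ scaled-mono-≤ j (subst (suc n₀ ℕ.≤_) (sym (ℕ.+-suc n e)) (ℕ.s≤s n₀≤n+e)) ⟩
      scaled j (n ℕ.+ suc e)            ≡⟨ scaled-homo-+ j n (suc e) ⟩
      scaled j n + scaled j (suc e)     ∎)
    where open ≤-Reasoning

  inScaledTriangle⇒inTriangle : ∀ {j n k} → InScaledTriangle j n k → InTriangle (scaled j n) (scaled j k)
  inScaledTriangle⇒inTriangle {j} {n} {k} (2k≤n , n≤2^j+k) =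
    scaled-nonNeg j k ,
    subst (_≤ scaled j n) (scaled-homo-+ j k k) (scaled-mono-≤ j 2k≤n) ,
    subst (scaled j n ≤_) (trans (scaled-homo-+ j (2 ℕ.^ j) k) (cong (_+ scaled j k) (scaled-2^ j)))
          (scaled-mono-≤ j n≤2^j+k)

  inTriangle⇒inScaledTriangle : ∀ j {n k x y} → InTriangle x y → Floor j x n → Floor j y k →
                                InScaledTriangle j n k
  inTriangle⇒inScaledTriangle j {n} {k} {x} {y} (_ , 2y≤x , x≤1+y) (n≤x , x<n+1) (k≤y , y<k+1) =
    ℕ.≤-pred (scaled-cancel-< j (begin-strict
      scaled j (k ℕ.+ k)               ≡⟨ scaled-homo-+ j k k ⟩
      scaled j k + scaled j k          ≤⟨ +-mono-≤ k≤y k≤y ⟩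
      y + y                            ≤⟨ 2y≤x ⟩
      x                                <⟨ x<n+1 ⟩
      scaled j (suc n)                 ∎)) ,
    ℕ.≤-pred (subst (suc n ℕ.≤_) (ℕ.+-suc P k) (scaled-cancel-< j (begin-strict
      scaled j n                       ≤⟨ n≤x ⟩
      x                                ≤⟨ x≤1+y ⟩
      1ℚ + y                           <⟨ +-monoʳ-< 1ℚ y<k+1 ⟩
      1ℚ + scaled j (suc k)            ≡⟨ cong (_+ scaled j (suc k)) (sym (scaled-2^ j)) ⟩
      scaled j P + scaled j (suc k)    ≡⟨ sym (scaled-homo-+ j P (suc k)) ⟩
      scaled j (P ℕ.+ suc k)           ∎)))
    where
    open ≤-Reasoning
    P = 2 ℕ.^ j

  inTriangle⇒y≤1 : ∀ {x y} → InTriangle x y → y ≤ 1ℚ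
  inTriangle⇒y≤1 {x} {y} (_ , 2y≤x , x≤1+y) = begin
    y                 ≡⟨ solve 1 (λ y → y := (y :+ y) :- y) refl y ⟩
    (y + y) - y       ≤⟨ +-monoˡ-≤ (- y) (≤-trans 2y≤x x≤1+y) ⟩
    (1ℚ + y) - y      ≡⟨ solve 1 (λ y → (con 1ℚ :+ y) :- y := con 1ℚ) refl y ⟩
    1ℚ                ∎
    where open ≤-Reasoning

  inTriangle⇒floors : ∀ j {x y} → InTriangle x y → Σ ℕ (Floor j x) × Σ ℕ (Floor j y)
  inTriangle⇒floors j {x} {y} tri@(0≤y , 2y≤x , x≤1+y) =
    floor-exists j (suc (P ℕ.+ P)) (≤-trans (+-mono-≤ 0≤y 0≤y) 2y≤x) x<2+1 ,
    floor-exists j (suc P) 0≤y y<1+1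
    where
    open ≤-Reasoning
    P = 2 ℕ.^ j
    y<1+1 : y < scaled j (suc P)
    y<1+1 = begin-strict
      y                        ≤⟨ inTriangle⇒y≤1 tri ⟩
      1ℚ                       ≡⟨ sym (scaled-2^ j) ⟩
      scaled j P               <⟨ scaled-mono-< j (ℕ.n<1+n P) ⟩
      scaled j (suc P)         ∎
    x<2+1 : x < scaled j (suc (P ℕ.+ P))
    x<2+1 = begin-strict
      x                        ≤⟨ x≤1+y ⟩
      1ℚ + y                   ≤⟨ +-monoʳ-≤ 1ℚ (inTriangle⇒y≤1 tri) ⟩
      1ℚ + 1ℚ                  ≡⟨ cong₂ _+_ (sym (scaled-2^ j)) (sym (scaled-2^ j)) ⟩
      scaled j P + scaled j P  ≡⟨ sym (scaled-homo-+ j P P) ⟩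
      scaled j (P ℕ.+ P)       <⟨ scaled-mono-< j (ℕ.n<1+n (P ℕ.+ P)) ⟩
      scaled j (suc (P ℕ.+ P)) ∎

  archimedean : ∀ ε → Positive ε → Σ ℕ λ M → 1ℚ ≤ fromℕ M * ε
  archimedean ε@(mkℚ +[1+ p ] d _) _ =
    suc d , subst (λ r → 1ℚ ≤ r * ε) (sym (fromℕ≡mkℚ (suc d))) (begin
      1ℚ                 ≡⟨ sym (*-inverseʳ [1+d]) ⟩
      [1+d] * 1/ [1+d]   ≤⟨ *-monoˡ-≤-nonNeg [1+d] 1/[1+d]≤ε ⟩
      [1+d] * ε          ∎)
    where
    open ≤-Reasoning
    [1+d] : ℚ
    [1+d] = mkℚ (+ suc d) 0 (Coprime.sym (Coprime.1-coprimeTo (suc d)))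
    1/[1+d]≤ε : 1/ [1+d] ≤ ε
    1/[1+d]≤ε = *≤* (ℤ.*-monoʳ-≤-nonNeg (+ suc d) {+ 1} {+ suc p} (ℤ.+≤+ (ℕ.s≤s ℕ.z≤n)))

  scaled< : ∀ {ε M} j a → 1ℚ ≤ fromℕ M * ε → a ℕ.* M ℕ.< 2 ℕ.^ j → scaled j a < ε
  scaled< {ε} {M} j a 1≤Mε aM<2^j =
    *-cancelʳ-<-nonNeg (fromℕ M) {{nonNegative (fromℕ-mono-≤ {0} {M} ℕ.z≤n)}} (begin-strict
      scaled j a * fromℕ M               ≡⟨ swap (fromℕ a) (halfPow j) (fromℕ M) ⟩
      (fromℕ a * fromℕ M) * halfPow j    ≡⟨ cong (_* halfPow j) (sym (fromℕ-homo-* a M)) ⟩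
      scaled j (a ℕ.* M)                 <⟨ scaled-mono-< j aM<2^j ⟩
      scaled j (2 ℕ.^ j)                 ≡⟨ scaled-2^ j ⟩
      1ℚ                                 ≤⟨ 1≤Mε ⟩
      fromℕ M * ε                        ≡⟨ *-comm (fromℕ M) ε ⟩
      ε * fromℕ M                        ∎)
    where
    open ≤-Reasoning
    swap : ∀ a h m → (a * h) * m ≡ (a * m) * h
    swap = solve 3 (λ a h m → (a :* h) :* m := (a :* m) :* h) refl

  -- realizable-near moves a lattice point by at most j + 1, and rounding down
  -- to the lattice costs less than one more step.
  gap : ℕ → ℚ
  gap j = scaled j (2 ℕ.+ j)

  gap-eventually< : ∀ ε → 0ℚ < ε → Σ ℕ λ H → ∀ j → H ℕ.≤ j → gap j + gap j < ε
  gap-eventually< ε 0<ε with archimedean ε (positive 0<ε)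
  ... | M , 1≤Mε = 2 ℕ.* M ℕ.+ 4 , λ j H≤j →
    subst (_< ε) (scaled-homo-+ j (2 ℕ.+ j) (2 ℕ.+ j))
          (scaled< {M = M} j (2 ℕ.+ j ℕ.+ (2 ℕ.+ j)) 1≤Mε
                   (subst (ℕ._< 2 ℕ.^ j) (regroup j M) ([2+n]*c<2^n H≤j)))
    where
    regroup : ∀ j M → (2 ℕ.+ j) ℕ.* (2 ℕ.* M) ≡ (2 ℕ.+ j ℕ.+ (2 ℕ.+ j)) ℕ.* M
    regroup = solve-∀

open Counting
open Dyadic
open import Data.Nat using (ℕ; suc; s≤s; _≥_)
import Data.Nat as ℕ
import Data.Nat.Properties as ℕ
open import Data.Rational using (ℚ; _+_; _<_; 0ℚ; _*_)
open import Data.Rational.Properties using (≤-refl)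

InS⇒near-triangle : ∀ {j ε} → gap j + gap j < ε → (n k : ℕ) → InS (suc j) n k →
  Σ ℚ λ x → Σ ℚ λ y → InTriangle x y × dist² (scaled j n) (scaled j k) x y < ε * ε
InS⇒near-triangle {j} 2gap<ε n k inS =
  scaled j (suc n) , scaled j k , inScaledTriangle⇒inTriangle {j} (InS⇒inScaledTriangle inS) ,
  dist²< (scaled-nonNeg j (2 ℕ.+ j)) 2gap<ε
    (near⇒close j (≤≤1+⇒near {j} (ℕ.n≤1+n n) ℕ.≤-refl)
                  (≤-refl , scaled-mono-< j (ℕ.n<1+n (suc n))))
    (near⇒close j (≤≤1+⇒near {j} ℕ.≤-refl (ℕ.n≤1+n k)) (≤-refl , scaled-mono-< j (ℕ.n<1+n k)))

floors⇒near-InS : ∀ {j ε x y} → gap j + gap j < ε → InTriangle x y →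
  Σ ℕ (Floor j x) → Σ ℕ (Floor j y) →
  Σ ℕ λ n → Σ ℕ λ k → InS (suc j) n k × dist² (scaled j n) (scaled j k) x y < ε * ε
floors⇒near-InS {j} 2gap<ε tri (n₀ , ⌊x⌋) (k₀ , ⌊y⌋) =
  let n , k , 1≤k , R , near-n , near-k =
        realizable-near {j} {n₀} {k₀} (inTriangle⇒inScaledTriangle j tri ⌊x⌋ ⌊y⌋)
  in n , k , realizable⇒InS 1≤k R ,
     dist²< (scaled-nonNeg j (2 ℕ.+ j)) 2gap<ε (near⇒close j near-n ⌊x⌋) (near⇒close j near-k ⌊y⌋)

proposition4p5 : (ε : ℚ) → 0ℚ < ε →
    Σ ℕ λ H → (h : ℕ) → h ≥ H → 1 Data.Nat.≤ h →
      ((n k : ℕ) → InS h n k →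
        Σ ℚ λ x → Σ ℚ λ y → InTriangle x y × dist² (normalize h n) (normalize h k) x y < ε * ε)
      × ((x y : ℚ) → InTriangle x y →
        Σ ℕ λ n → Σ ℕ λ k → InS h n k × dist² (normalize h n) (normalize h k) x y < ε * ε)
proposition4p5 ε 0<ε =
  let H , 2gap<ε = gap-eventually< ε 0<ε
  in suc H , λ where
    (suc j) (s≤s H≤j) _ →
      InS⇒near-triangle (2gap<ε j H≤j) ,
      λ x y tri → uncurry (floors⇒near-InS (2gap<ε j H≤j) tri) (inTriangle⇒floors j tri)
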